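{- Let $u \in \mathsf{Rec}(D_{m,n})$. The following are equivalent: (i) $u$ is minimal, (ii) $f_{m,n}(u)$ is a ribbon polyomino, i.e. a parallelogram polyomino with bounding rectangle $[0,m]\times[0,n]$ of area $m+n-1$, and (iii) $\mathsf{level}(u)=0$.
   Context: $D_{m,n}$ is the complete bipartite digraph with top vertices $v_0,\dots,v_{m-1}$ and bottom vertices $v_m,\dots,v_{m+n-1}$, sink $v_0$; $\mathsf{Rec}(D_{m,n})$ its recurrent sandpile configurations. $\mathsf{level}(u)=u_1+\cdots+u_{m+n-1}-n(m-1)$; $u$ is minimal if $\mathsf{level}(u)$ is as small as possible over recurrent configurations. $f_{m,n}(u)$ is the intersection of the Young diagram with corner $(m,0)$ and column heights $(n,1+a_{m-1},\ldots,1+a_1)$ with the Young diagram with corner $(0,n)$ and row widths $(1+b_n,\ldots,1+b_1)$, where $a$ and $b$ are the sorted top and bottom heights. Parallelogram polyominoes are polyominoes meeting every line of slope $-1$ in a connected segment; $m+n-1$ is the minimal area in the $m\times n$ box. -}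

module Defs where

open import Data.Nat using (ℕ; zero; suc; _+_; _*_; _∸_; _≤_; _<_; _≟_)
open import Data.Nat.Properties using (≤-decTotalOrder)
open import Data.Fin using (Fin)
open import Data.Sum using (_⊎_; inj₁; inj₂)
open import Data.Product using (Σ; ∃; ∃-syntax; _×_; _,_)
open import Data.Bool using (Bool; true; false; if_then_else_; _∧_)
open import Data.List using (List; []; _∷_; map; allFin; length)
open import Data.Nat.ListAction using (sum)
open import Data.List.Membership.Propositional using (_∈_)
open import Data.Integer as ℤ using (ℤ; +_; _-_)
open import Relation.Nullary.Decidable using (⌊_⌋)
open import Relation.Binary.PropositionalEquality using (_≡_)
open import Relation.Binary.Construct.Closure.ReflexiveTransitive using (Star)
open import Function.Bundles using (_⇔_)
open import Data.List.Sort ≤-decTotalOrder using (sort)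

-- Top vertices v_0,…,v_{m-1}, bottom vertices v_m,…,v_{m+n-1}; every
-- top vertex has an arc to every bottom vertex and vice versa.  The sink
-- is v_0.  Non-sink vertices: top v_1,…,v_{m-1} (indexed by Fin (m ∸ 1),
-- index i standing for v_{i+1}) and bottom v_m,…,v_{m+n-1} (indexed by
-- Fin n, index j standing for v_{m+j}).

NonSink : ℕ → ℕ → Set
NonSink m n = Fin (m ∸ 1) ⊎ Fin n

Config : ℕ → ℕ → Set
Config m n = NonSink m n → ℕ

deg : (m n : ℕ) → NonSink m n → ℕ
deg m n (inj₁ _) = n
deg m n (inj₂ _) = m

eqFin : {k : ℕ} → Fin k → Fin k → Bool
eqFin i j = ⌊ Data.Fin._≟_ i j ⌋

-- toppling vertex v: v loses deg v grains, each out-neighbour gains one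
-- (grains sent to the sink v_0 disappear)
topple : (m n : ℕ) → Config m n → NonSink m n → Config m n
topple m n c (inj₁ i) (inj₁ j) = if eqFin i j then c (inj₁ j) ∸ n else c (inj₁ j)
topple m n c (inj₁ i) (inj₂ k) = suc (c (inj₂ k))
topple m n c (inj₂ k) (inj₁ j) = suc (c (inj₁ j))
topple m n c (inj₂ k) (inj₂ l) = if eqFin k l then c (inj₂ l) ∸ m else c (inj₂ l)

LegalStep : (m n : ℕ) → Config m n → Config m n → Set
LegalStep m n c c' =
  Σ (NonSink m n) λ v → (deg m n v ≤ c v) × (∀ w → c' w ≡ topple m n c v w)

Reaches : (m n : ℕ) → Config m n → Config m n → Set
Reaches m n = Star (LegalStep m n)

Stable : (m n : ℕ) → Config m n → Set
Stable m n c = ∀ v → c v < deg m n v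

Recurrent : (m n : ℕ) → Config m n → Set
Recurrent m n u =
  Stable m n u ×
  Σ (Config m n) λ d → (∃[ w ] 0 < d w) × Reaches m n (λ w → u w + d w) u

topHeights : (m n : ℕ) → Config m n → List ℕ
topHeights m n u = map (λ i → u (inj₁ i)) (allFin (m ∸ 1))

bottomHeights : (m n : ℕ) → Config m n → List ℕ
bottomHeights m n u = map (λ j → u (inj₂ j)) (allFin n)

level : (m n : ℕ) → Config m n → ℤ
level m n u =
  + (sum (topHeights m n u) + sum (bottomHeights m n u)) - + (n * (m ∸ 1))

Minimal : (m n : ℕ) → Config m n → Set
Minimal m n u = ∀ v → Recurrent m n v → level m n u ℤ.≤ level m n v

-- k-th entry (0-based) of a list, 0 if out of range (never used here)
nth : List ℕ → ℕ → ℕ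
nth []       _       = 0
nth (x ∷ xs) zero    = x
nth (x ∷ xs) (suc k) = nth xs k

-- a_1 ≤ ⋯ ≤ a_{m-1} (sorted top heights): a_k = nth sortedTop (k-1)
sortedTop : (m n : ℕ) → Config m n → List ℕ
sortedTop m n u = sort (topHeights m n u)

-- b_1 ≤ ⋯ ≤ b_n (sorted bottom heights): b_k = nth sortedBottom (k-1)
sortedBottom : (m n : ℕ) → Config m n → List ℕ
sortedBottom m n u = sort (bottomHeights m n u)

-- A cell (x , y) is the unit square [x,x+1] × [y,y+1].
-- Young diagram with corner (m,0) and column heights
-- (n, 1+a_{m-1}, …, 1+a_1) listed from the corner leftwards:
-- column m-1 has height n, column x ≤ m-2 has height 1 + a_{x+1}.
colHeight : (m n : ℕ) → Config m n → ℕ → ℕ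
colHeight m n u x = if ⌊ suc x ≟ m ⌋ then n else suc (nth (sortedTop m n u) x)

inA : (m n : ℕ) → Config m n → ℕ → ℕ → Bool
inA m n u x y = ⌊ suc x Data.Nat.≤? m ⌋ ∧ ⌊ suc y Data.Nat.≤? colHeight m n u x ⌋

-- Young diagram with corner (0,n) and row widths (1+b_n, …, 1+b_1)
-- listed from the corner downwards: row y has width 1 + b_{y+1}.
rowWidth : (m n : ℕ) → Config m n → ℕ → ℕ
rowWidth m n u y = suc (nth (sortedBottom m n u) y)

inB : (m n : ℕ) → Config m n → ℕ → ℕ → Bool
inB m n u x y = ⌊ suc y Data.Nat.≤? n ⌋ ∧ ⌊ suc x Data.Nat.≤? rowWidth m n u y ⌋

f : (m n : ℕ) → Config m n → ℕ → ℕ → Bool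
f m n u x y = inA m n u x y ∧ inB m n u x y

data Step : Set where
  N E : Step

countE : List Step → ℕ
countE []      = 0
countE (N ∷ s) = countE s
countE (E ∷ s) = suc (countE s)

countN : List Step → ℕ
countN []      = 0
countN (N ∷ s) = suc (countN s)
countN (E ∷ s) = countN s

pointsFrom : ℕ → ℕ → List Step → List (ℕ × ℕ)
pointsFrom x y []      = (x , y) ∷ []
pointsFrom x y (N ∷ s) = (x , y) ∷ pointsFrom x (suc y) s
pointsFrom x y (E ∷ s) = (x , y) ∷ pointsFrom (suc x) y s

-- heights (y-coordinates) of the successive E steps, started at height y;
-- entry x is the height at which the path crosses column [x,x+1]
eHeightsFrom : ℕ → List Step → List ℕ
eHeightsFrom y []      = []
eHeightsFrom y (N ∷ s) = eHeightsFrom (suc y) s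
eHeightsFrom y (E ∷ s) = y ∷ eHeightsFrom y s

IsPath : ℕ → ℕ → List Step → Set
IsPath m n p = (countE p ≡ m) × (countN p ≡ n)

-- S (a set of cells) is a parallelogram polyomino with bounding rectangle
-- [0,m] × [0,n]: it is the region enclosed by an upper path U and a
-- lower path L, both N/E lattice paths from (0,0) to (m,n), which meet
-- only at their endpoints (U starting with a north step).
ParallelogramPolyomino : ℕ → ℕ → (ℕ → ℕ → Bool) → Set
ParallelogramPolyomino m n S =
  Σ (List Step) λ U → Σ (List Step) λ L →
    IsPath m n (N ∷ U) × IsPath m n L ×
    (∀ q → q ∈ pointsFrom 0 0 (N ∷ U) → q ∈ pointsFrom 0 0 L →
           (q ≡ (0 , 0)) ⊎ (q ≡ (m , n))) ×
    (∀ x y → (S x y ≡ true) ⇔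
       ((x < m) × (nth (eHeightsFrom 0 L) x ≤ y) × (y < nth (eHeightsFrom 0 (N ∷ U)) x)))

areaIn : ℕ → ℕ → (ℕ → ℕ → Bool) → ℕ
areaIn m n S =
  sum (map (λ x → sum (map (λ y → if S (Data.Fin.toℕ x) (Data.Fin.toℕ y) then 1 else 0)
                            (allFin n)))
           (allFin m))

Ribbon : ℕ → ℕ → (ℕ → ℕ → Bool) → Set
Ribbon m n S = ParallelogramPolyomino m n S × (areaIn m n S ≡ m + n ∸ 1)

-- Let a and b be the sorted top and bottom heights of a stable u.  Column x
-- of f(u) consists of the cells lo x ≤ y < hi x, where hi x is the column
-- height of the first Young diagram and lo x = #{j : b_j < x}.
--  * Toppling bookkeeping and Dhar's burning criterion show that for
--    recurrent u consecutive columns overlap: lo (x+1) < hi x.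
--  * Hence f(u) is the region between two lattice paths meeting only at
--    their ends (a parallelogram polyomino), built from the heights hi, lo.
--  * Counting cells column by column and using the conjugation identity
--    Σ_x lo x + Σ b = n (m - 1) gives area + n(m-1) = (m-1+n) + Σ heights,
--    while overlapping columns give area ≥ m + n - 1.  So level(u) ≥ 0, with
--    equality iff f(u) has the minimal area m + n - 1, i.e. is a ribbon.
--  * An explicit recurrent configuration of level 0 shows that minimal
--    means level 0.
module Submission where

open import Defs
open import Data.Nat
open import Data.Nat.Properties
open import Data.Nat.ListAction using (sum)
open import Data.Nat.ListAction.Properties using (sum-↭)
open import Data.Bool using (Bool; true; false; if_then_else_; T; not)
open import Data.Unit using (tt)
open import Data.Empty using (⊥; ⊥-elim)
open import Data.Sum using (_⊎_; inj₁; inj₂)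
open import Data.Sum.Properties using (≡-dec)
open import Data.Product using (Σ; _×_; _,_; proj₁; proj₂)
open import Data.Fin as Fin using (Fin; zero; suc; toℕ; fromℕ<)
open import Data.Fin.Properties using (toℕ-fromℕ<; toℕ<n; toℕ-injective)
open import Data.List using (List; []; _∷_; length; map; tabulate; allFin; applyUpTo)
open import Data.List.Properties using (map-tabulate; length-map; length-tabulate; length-applyUpTo)
open import Data.List.Relation.Unary.All using (All; []; _∷_)
import Data.List.Relation.Unary.All as All
open import Data.List.Relation.Unary.All.Properties using (map⁺; tabulate⁺; applyUpTo⁺₁)
open import Data.List.Relation.Unary.Linked using (Linked; []; [-]; _∷_)
open import Data.List.Relation.Unary.Linked.Properties using (Linked⇒All)
import Data.List.Relation.Unary.Linked as Linked
open import Data.List.Relation.Unary.Any using (here; there)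
open import Data.List.Membership.Propositional using (_∈_)
open import Data.List.Relation.Binary.Permutation.Propositional as ↭ using (_↭_; ↭-sym)
open import Data.List.Relation.Binary.Permutation.Propositional.Properties using (All-resp-↭; ↭-length)
open import Data.List.Sort ≤-decTotalOrder using (sort; sort-↭; sort-↗)
open import Data.Integer as ℤ using (ℤ; +_)
open import Data.Integer.Properties using ([+m]-[+n]≡m⊖n; ⊖-≥; i-j≡0⇒i≡j; i≡j⇒i-j≡0)
  renaming (+-injective to ℤ+-injective; ≤-antisym to ℤ-≤-antisym)
open import Relation.Nullary using (¬_; yes; no; Dec)
open import Relation.Nullary.Decidable using (toWitness; toWitnessFalse)
open import Data.Nat.Tactic.RingSolver using (solve-∀)
open import Relation.Binary.PropositionalEquality
open import Relation.Binary.Definitions using (tri<; tri≈; tri>)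
open import Relation.Binary.Construct.Closure.ReflexiveTransitive using (ε; _◅_; _◅◅_)
open import Function.Base using (id; case_of_)
open import Algebra.Properties.CommutativeSemigroup +-commutativeSemigroup using (interchange)
open import Function.Bundles using (_⇔_; mk⇔; Equivalence)

count : {A : Set} → (A → Bool) → List A → ℕ
count p []       = 0
count p (x ∷ xs) = if p x then suc (count p xs) else count p xs

count-map : {A B : Set} (p : B → Bool) (g : A → B) (xs : List A) →
            count p (map g xs) ≡ count (λ x → p (g x)) xs
count-map p g []       = refl
count-map p g (x ∷ xs) with p (g x)
... | true  = cong suc (count-map p g xs)
... | false = count-map p g xs

-- Counting is invariant under permutation (needed because f sorts the heights).
count-↭ : {A : Set} (p : A → Bool) {xs ys : List A} → xs ↭ ys → count p xs ≡ count p ys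
count-↭ p ↭.refl = refl
count-↭ p (↭.prep x r) with p x
... | true  = cong suc (count-↭ p r)
... | false = count-↭ p r
count-↭ p (↭.swap x y r) with p x | p y
... | true  | true  = cong (λ k → suc (suc k)) (count-↭ p r)
... | true  | false = cong suc (count-↭ p r)
... | false | true  = cong suc (count-↭ p r)
... | false | false = count-↭ p r
count-↭ p (↭.trans r r′) = trans (count-↭ p r) (count-↭ p r′)

count-witness : {A : Set} (p : A → Bool) (xs : List A) → 1 ≤ count p xs → Σ A λ x → p x ≡ true
count-witness p (x ∷ xs) pos with p x in e
... | true  = x , e
... | false = count-witness p xs pos

-- Pigeonhole: if every index satisfying Q occurs in ys, then there are at
-- most length ys such indices.  Proved by deleting index zero from ys and
-- shifting the remaining indices down.
private
  dropZero : ∀ {n} → List (Fin (suc n)) → List (Fin n)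
  dropZero []           = []
  dropZero (zero ∷ ys)  = dropZero ys
  dropZero (suc j ∷ ys) = j ∷ dropZero ys

  dropZero-length : ∀ {n} (ys : List (Fin (suc n))) → length (dropZero ys) ≤ length ys
  dropZero-length []           = z≤n
  dropZero-length (zero ∷ ys)  = m≤n⇒m≤1+n (dropZero-length ys)
  dropZero-length (suc j ∷ ys) = s≤s (dropZero-length ys)

  dropZero-length-∈ : ∀ {n} (ys : List (Fin (suc n))) → zero ∈ ys →
                      length (dropZero ys) < length ys
  dropZero-length-∈ (zero ∷ ys)  _         = s≤s (dropZero-length ys)
  dropZero-length-∈ (suc j ∷ ys) (there p) = s≤s (dropZero-length-∈ ys p)

  dropZero-∈ : ∀ {n} (ys : List (Fin (suc n))) j → suc j ∈ ys → j ∈ dropZero ys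
  dropZero-∈ (zero ∷ ys)   j (there p)   = dropZero-∈ ys j p
  dropZero-∈ (suc _ ∷ ys)  j (here refl) = here refl
  dropZero-∈ (suc _ ∷ ys)  j (there p)   = there (dropZero-∈ ys j p)

  dropZero-covers : ∀ {n} {Q : Fin (suc n) → Bool} (ys : List (Fin (suc n))) →
                    (∀ j → Q j ≡ true → j ∈ ys) → ∀ j → Q (suc j) ≡ true → j ∈ dropZero ys
  dropZero-covers ys covers j q = dropZero-∈ ys j (covers (suc j) q)

  count-tabulate-suc : ∀ n (Q : Fin (suc n) → Bool) →
                       count Q (tabulate {n = n} suc) ≡ count (λ j → Q (suc j)) (allFin n)
  count-tabulate-suc n Q =
    trans (cong (count Q) (sym (map-tabulate {n = n} id suc))) (count-map Q suc (allFin n))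

  count-allFin-suc : ∀ n (Q : Fin (suc n) → Bool) →
    count Q (allFin (suc n)) ≡
      (if Q zero then suc (count (λ j → Q (suc j)) (allFin n)) else count (λ j → Q (suc j)) (allFin n))
  count-allFin-suc n Q with Q zero
  ... | true  = cong suc (count-tabulate-suc n Q)
  ... | false = count-tabulate-suc n Q

pigeonhole : ∀ n (Q : Fin n → Bool) (ys : List (Fin n)) →
             (∀ j → Q j ≡ true → j ∈ ys) → count Q (allFin n) ≤ length ys
pigeonhole zero    Q ys covers = z≤n
pigeonhole (suc n) Q ys covers rewrite count-allFin-suc n Q with Q zero in e
... | true  = ≤-trans (s≤s (pigeonhole n _ (dropZero ys) (dropZero-covers ys covers)))
                      (dropZero-length-∈ ys (covers zero e))
... | false = ≤-trans (pigeonhole n _ (dropZero ys) (dropZero-covers ys covers)) (dropZero-length ys)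

<ᵇ-true⇒< : ∀ {h x} → (h <ᵇ x) ≡ true → h < x
<ᵇ-true⇒< {h} {x} e = <ᵇ⇒< h x (subst T (sym e) tt)

<ᵇ-false⇒≥ : ∀ {h x} → (h <ᵇ x) ≡ false → x ≤ h
<ᵇ-false⇒≥ e = ≮⇒≥ λ h<x → subst T e (<⇒<ᵇ h<x)

<⇒<ᵇ-true : ∀ {h x} → h < x → (h <ᵇ x) ≡ true
<⇒<ᵇ-true {h} {x} h<x with h <ᵇ x in e
... | true  = refl
... | false = ⊥-elim (<⇒≱ h<x (<ᵇ-false⇒≥ e))

≥⇒<ᵇ-false : ∀ {h x} → x ≤ h → (h <ᵇ x) ≡ false
≥⇒<ᵇ-false {h} {x} x≤h with h <ᵇ x in e
... | true  = ⊥-elim (<⇒≱ (<ᵇ-true⇒< e) x≤h)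
... | false = refl

Sorted : List ℕ → Set
Sorted = Linked _≤_

All-nth : ∀ {P : ℕ → Set} {l} → All P l → ∀ y → y < length l → P (nth l y)
All-nth (p ∷ _)  zero    _       = p
All-nth (_ ∷ ps) (suc y) (s≤s q) = All-nth ps y q

nth-mono : ∀ {l} → Sorted l → ∀ x → suc x < length l → nth l x ≤ nth l (suc x)
nth-mono [-]     zero    (s≤s ())
nth-mono (p ∷ _) zero    _       = p
nth-mono (_ ∷ s) (suc x) (s≤s q) = nth-mono s x q

nth-applyUpTo : ∀ h k t → t < k → nth (applyUpTo h k) t ≡ h t
nth-applyUpTo h (suc k) zero    _       = refl
nth-applyUpTo h (suc k) (suc t) (s≤s p) = nth-applyUpTo (λ x → h (suc x)) k t p

applyUpTo-sorted : ∀ h k y → (0 < k → y ≤ h 0) → (∀ t → suc t < k → h t ≤ h (suc t)) →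
                   Sorted (y ∷ applyUpTo h k)
applyUpTo-sorted h zero    y _    _    = [-]
applyUpTo-sorted h (suc k) y y≤h₀ mono =
  y≤h₀ z<s ∷ applyUpTo-sorted (λ x → h (suc x)) k (h 0) (λ p → mono 0 (s≤s p)) (λ t p → mono (suc t) (s≤s p))

-- below x l : the number of entries of l that are smaller than x.
-- For the sorted bottom heights this is the conjugate partition.
below : ℕ → List ℕ → ℕ
below x = count (λ h → h <ᵇ x)

below-zero : ∀ l → below 0 l ≡ 0
below-zero []      = refl
below-zero (_ ∷ l) = below-zero l

below-length : ∀ x l → below x l ≤ length l
below-length x []      = z≤n
below-length x (h ∷ l) with h <ᵇ x
... | true  = s≤s (below-length x l)
... | false = m≤n⇒m≤1+n (below-length x l)

below-mono : ∀ x l → below x l ≤ below (suc x) l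
below-mono x []      = z≤n
below-mono x (h ∷ l) with h <ᵇ x in e | h <ᵇ suc x in e′
... | true  | true  = s≤s (below-mono x l)
... | true  | false = ⊥-elim (<⇒≱ (<ᵇ-true⇒< e) (≤-trans (n≤1+n x) (<ᵇ-false⇒≥ e′)))
... | false | true  = m≤n⇒m≤1+n (below-mono x l)
... | false | false = below-mono x l

below-allAbove : ∀ {x l} → All (x ≤_) l → below x l ≡ 0
below-allAbove []                      = refl
below-allAbove {x} (_∷_ {h} x≤h rest) rewrite ≥⇒<ᵇ-false {h} {x} x≤h = below-allAbove rest

below-≤⇔ : ∀ {l} → Sorted l → ∀ x y → y < length l → (x ≤ nth l y ⇔ below x l ≤ y)
below-≤⇔ {h ∷ t} s x y y<len with h <ᵇ x in e
below-≤⇔ {h ∷ t} s x zero    _ | true =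
  mk⇔ (λ x≤h → ⊥-elim (<⇒≱ (<ᵇ-true⇒< e) x≤h)) (λ ())
below-≤⇔ {h ∷ t} s x (suc y) (s≤s y<len) | true =
  mk⇔ (λ x≤ly → s≤s (Equivalence.to rest x≤ly)) (λ b≤y → Equivalence.from rest (s≤s⁻¹ b≤y))
  where
  rest : x ≤ nth t y ⇔ below x t ≤ y
  rest = below-≤⇔ (Linked.tail s) x y y<len
below-≤⇔ {h ∷ t} s x y y<len | false =
  mk⇔ (λ _ → subst (_≤ y) (sym (below-allAbove (All.tail aboveX))) z≤n)
      (λ _ → All-nth aboveX y y<len)
  where
  aboveX : All (x ≤_) (h ∷ t)
  aboveX = Linked⇒All ≤-trans (<ᵇ-false⇒≥ e) s

sumUpTo : ℕ → (ℕ → ℕ) → ℕ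
sumUpTo k g = sum (applyUpTo g k)

sumUpTo-snoc : ∀ k g → sumUpTo (suc k) g ≡ sumUpTo k g + g k
sumUpTo-snoc zero    g = +-comm (g 0) 0
sumUpTo-snoc (suc k) g = trans (cong (λ z → g 0 + z) (sumUpTo-snoc k (λ x → g (suc x))))
                               (sym (+-assoc (g 0) _ _))

sumUpTo-cong : ∀ k {g h} → (∀ x → x < k → g x ≡ h x) → sumUpTo k g ≡ sumUpTo k h
sumUpTo-cong zero    eq = refl
sumUpTo-cong (suc k) eq = cong₂ _+_ (eq 0 z<s) (sumUpTo-cong k (λ x x<k → eq (suc x) (s≤s x<k)))

sumUpTo-+ : ∀ k g h → sumUpTo k (λ x → g x + h x) ≡ sumUpTo k g + sumUpTo k h
sumUpTo-+ zero    g h = refl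
sumUpTo-+ (suc k) g h = trans (cong (λ z → g 0 + h 0 + z) (sumUpTo-+ k (λ x → g (suc x)) (λ x → h (suc x))))
                              (interchange (g 0) (h 0) _ _)

sumUpTo-const : ∀ k c → sumUpTo k (λ _ → c) ≡ k * c
sumUpTo-const zero    c = refl
sumUpTo-const (suc k) c = cong (λ z → c + z) (sumUpTo-const k c)

tabulate-toℕ : ∀ n (G : ℕ → ℕ) → tabulate {n = n} (λ i → G (toℕ i)) ≡ applyUpTo G n
tabulate-toℕ zero    G = refl
tabulate-toℕ (suc n) G = cong (G 0 ∷_) (tabulate-toℕ n (λ x → G (suc x)))

sum-allFin : ∀ n (G : ℕ → ℕ) → sum (map (λ i → G (toℕ i)) (allFin n)) ≡ sumUpTo n G
sum-allFin n G = cong sum (trans (map-tabulate {n = n} id (λ i → G (toℕ i))) (tabulate-toℕ n G))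

applyUpTo-nth : ∀ l → applyUpTo (nth l) (length l) ≡ l
applyUpTo-nth []      = refl
applyUpTo-nth (x ∷ l) = cong (x ∷_) (applyUpTo-nth l)

sum-nth : ∀ l → sumUpTo (length l) (nth l) ≡ sum l
sum-nth l = cong sum (applyUpTo-nth l)

indicator : Bool → ℕ
indicator b = if b then 1 else 0

sumUpTo-initial : ∀ n c → c ≤ n → sumUpTo n (λ y → indicator (y <ᵇ c)) ≡ c
sumUpTo-initial n       zero    _       = trans (sumUpTo-const n 0) (*-zeroʳ n)
sumUpTo-initial (suc n) (suc c) (s≤s p) = cong suc (sumUpTo-initial n c p)

sumUpTo-interval : ∀ n lo hi → lo ≤ hi → hi ≤ n → (g : ℕ → ℕ) →
  (∀ y → y < n → g y + indicator (y <ᵇ lo) ≡ indicator (y <ᵇ hi)) → sumUpTo n g ≡ hi ∸ lo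
sumUpTo-interval n lo hi lo≤hi hi≤n g split = begin
  sumUpTo n g                                                        ≡⟨ m+n∸n≡m _ lo ⟨
  sumUpTo n g + lo ∸ lo                                              ≡⟨ cong (λ z → sumUpTo n g + z ∸ lo) (sumUpTo-initial n lo (≤-trans lo≤hi hi≤n)) ⟨
  sumUpTo n g + sumUpTo n (λ y → indicator (y <ᵇ lo)) ∸ lo           ≡⟨ cong (_∸ lo) (sumUpTo-+ n g _) ⟨
  sumUpTo n (λ y → g y + indicator (y <ᵇ lo)) ∸ lo                   ≡⟨ cong (_∸ lo) (sumUpTo-cong n split) ⟩
  sumUpTo n (λ y → indicator (y <ᵇ hi)) ∸ lo                         ≡⟨ cong (_∸ lo) (sumUpTo-initial n hi hi≤n) ⟩
  hi ∸ lo                                                            ∎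
  where open ≡-Reasoning

sumUpTo-above : ∀ m h → h < m → sumUpTo m (λ x → indicator (h <ᵇ x)) + h ≡ m ∸ 1
sumUpTo-above (suc m) zero    _       = trans (+-identityʳ _) (trans (sumUpTo-const m 1) (*-identityʳ m))
sumUpTo-above (suc m@(suc _)) (suc h) (s≤s p) = trans (+-suc _ h) (cong suc (sumUpTo-above m h p))

below-∷ : ∀ x h t → below x (h ∷ t) ≡ indicator (h <ᵇ x) + below x t
below-∷ x h t with h <ᵇ x
... | true  = refl
... | false = refl

sumUpTo-below : ∀ m l → All (_< m) l → sumUpTo m (λ x → below x l) + sum l ≡ length l * (m ∸ 1)
sumUpTo-below m []      []       = trans (+-identityʳ _) (trans (sumUpTo-const m 0) (*-zeroʳ m))
sumUpTo-below m (h ∷ t) (h<m ∷ t<m) = begin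
  sumUpTo m (λ x → below x (h ∷ t)) + (h + sum t)
    ≡⟨ cong (_+ (h + sum t)) (trans (sumUpTo-cong m (λ x _ → below-∷ x h t)) (sumUpTo-+ m _ _)) ⟩
  (sumUpTo m (λ x → indicator (h <ᵇ x)) + sumUpTo m (λ x → below x t)) + (h + sum t)
    ≡⟨ interchange (sumUpTo m (λ x → indicator (h <ᵇ x))) (sumUpTo m (λ x → below x t)) h (sum t) ⟩
  (sumUpTo m (λ x → indicator (h <ᵇ x)) + h) + (sumUpTo m (λ x → below x t) + sum t)
    ≡⟨ cong₂ _+_ (sumUpTo-above m h h<m) (sumUpTo-below m t t<m) ⟩
  (m ∸ 1) + length t * (m ∸ 1)                                                     ∎
  where open ≡-Reasoning

eqFin-true : ∀ {k} {i j : Fin k} → eqFin i j ≡ true → i ≡ j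
eqFin-true {i = i} {j} e = toWitness {a? = i Fin.≟ j} (subst T (sym e) tt)

eqFin-false : ∀ {k} {i j : Fin k} → eqFin i j ≡ false → ¬ i ≡ j
eqFin-false {i = i} {j} e = toWitnessFalse {a? = i Fin.≟ j} (subst (λ b → T (not b)) (sym e) tt)

module Toppling (m n : ℕ) where

  Vertex : Set
  Vertex = NonSink m n

  -- Boolean equality of vertices, computed by the same test as topple.
  _==_ : Vertex → Vertex → Bool
  inj₁ i == inj₁ j = eqFin i j
  inj₂ k == inj₂ l = eqFin k l
  inj₁ _ == inj₂ _ = false
  inj₂ _ == inj₁ _ = false

  ==-true : ∀ v w → (v == w) ≡ true → v ≡ w
  ==-true (inj₁ i) (inj₁ j) e = cong inj₁ (eqFin-true e)
  ==-true (inj₂ k) (inj₂ l) e = cong inj₂ (eqFin-true e)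

  topplingsOf : Vertex → List Vertex → ℕ
  topplingsOf w = count (_== w)

  toppledTops : List Vertex → List (Fin (m ∸ 1))
  toppledTops []            = []
  toppledTops (inj₁ i ∷ vs) = i ∷ toppledTops vs
  toppledTops (inj₂ _ ∷ vs) = toppledTops vs

  toppledBottoms : List Vertex → List (Fin n)
  toppledBottoms []            = []
  toppledBottoms (inj₁ _ ∷ vs) = toppledBottoms vs
  toppledBottoms (inj₂ j ∷ vs) = j ∷ toppledBottoms vs

  neighbourTopplings : Vertex → List Vertex → ℕ
  neighbourTopplings (inj₁ _) vs = length (toppledBottoms vs)
  neighbourTopplings (inj₂ _) vs = length (toppledTops vs)

  adjacent : Vertex → Vertex → ℕ
  adjacent (inj₁ _) (inj₂ _) = 1
  adjacent (inj₂ _) (inj₁ _) = 1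
  adjacent (inj₁ _) (inj₁ _) = 0
  adjacent (inj₂ _) (inj₂ _) = 0

  neighbourTopplings-∷ : ∀ v w vs →
    neighbourTopplings w (v ∷ vs) ≡ adjacent v w + neighbourTopplings w vs
  neighbourTopplings-∷ (inj₁ _) (inj₁ _) vs = refl
  neighbourTopplings-∷ (inj₁ _) (inj₂ _) vs = refl
  neighbourTopplings-∷ (inj₂ _) (inj₁ _) vs = refl
  neighbourTopplings-∷ (inj₂ _) (inj₂ _) vs = refl

  topplingsOf-∷ : ∀ v w vs → topplingsOf w (v ∷ vs) ≡ indicator (v == w) + topplingsOf w vs
  topplingsOf-∷ v w vs with v == w
  ... | true  = refl
  ... | false = refl

  private
    restore : ∀ a d → d ≤ a → a ∸ d + d * 1 ≡ a + 0
    restore a d d≤a = trans (cong (λ z → a ∸ d + z) (*-identityʳ d)) (trans (m∸n+n≡m d≤a) (sym (+-identityʳ a)))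

    unchanged : ∀ a d → a + d * 0 ≡ a + 0
    unchanged a d = cong (λ z → a + z) (*-zeroʳ d)

    gained : ∀ a d → suc a + d * 0 ≡ a + 1
    gained = solve-∀

  topple-balance : ∀ c v → deg m n v ≤ c v → ∀ w →
    topple m n c v w + deg m n w * indicator (v == w) ≡ c w + adjacent v w
  topple-balance c (inj₁ i) le (inj₁ j) with eqFin i j in e
  ... | true  rewrite eqFin-true e = restore (c (inj₁ j)) n le
  ... | false = unchanged (c (inj₁ j)) n
  topple-balance c (inj₂ k) le (inj₂ l) with eqFin k l in e
  ... | true  rewrite eqFin-true e = restore (c (inj₂ l)) m le
  ... | false = unchanged (c (inj₂ l)) m
  topple-balance c (inj₁ i) le (inj₂ k) = gained (c (inj₂ k)) m
  topple-balance c (inj₂ k) le (inj₁ j) = gained (c (inj₁ j)) n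

  trace : ∀ {c u} → Reaches m n c u → List Vertex
  trace ε                = []
  trace ((v , _ , _) ◅ s) = v ∷ trace s

  balance : ∀ {c u} (s : Reaches m n c u) w →
    u w + deg m n w * topplingsOf w (trace s) ≡ c w + neighbourTopplings w (trace s)
  balance {c} ε w = trans (cong (λ z → c w + z) (*-zeroʳ (deg m n w))) (noTopplings w)
    where
    noTopplings : ∀ w → c w + 0 ≡ c w + neighbourTopplings w []
    noTopplings (inj₁ _) = refl
    noTopplings (inj₂ _) = refl
  balance {c} {u} (_◅_ {j = c′} (v , le , eq) s) w = begin
    u w + D * topplingsOf w (v ∷ vs)            ≡⟨ cong (λ z → u w + D * z) (topplingsOf-∷ v w vs) ⟩
    u w + D * (indicator (v == w) + topplingsOf w vs)
                                                ≡⟨ regroup (u w) D (indicator (v == w)) (topplingsOf w vs) ⟩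
    (u w + D * topplingsOf w vs) + D * indicator (v == w)
                                                ≡⟨ cong (_+ D * indicator (v == w)) (balance s w) ⟩
    (c′ w + neighbourTopplings w vs) + D * indicator (v == w)
                                                ≡⟨ swap-last (c′ w) _ _ ⟩
    (c′ w + D * indicator (v == w)) + neighbourTopplings w vs
                                                ≡⟨ cong (_+ neighbourTopplings w vs) (trans (cong (_+ D * indicator (v == w)) (eq w)) (topple-balance c v le w)) ⟩
    (c w + adjacent v w) + neighbourTopplings w vs
                                                ≡⟨ +-assoc (c w) _ _ ⟩
    c w + (adjacent v w + neighbourTopplings w vs)
                                                ≡⟨ cong (λ z → c w + z) (neighbourTopplings-∷ v w vs) ⟨
    c w + neighbourTopplings w (v ∷ vs)         ∎
    where
    open ≡-Reasoning
    D : ℕ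
    D = deg m n w
    vs : List Vertex
    vs = trace s
    regroup : ∀ a d e o → a + d * (e + o) ≡ a + d * o + d * e
    regroup = solve-∀
    swap-last : ∀ a b c → a + b + c ≡ a + c + b
    swap-last = solve-∀

  topplingsOf-∉ : ∀ w vs → ¬ w ∈ vs → topplingsOf w vs ≡ 0
  topplingsOf-∉ w []       _  = refl
  topplingsOf-∉ w (v ∷ vs) w∉ with v == w in e
  ... | true  = ⊥-elim (w∉ (here (sym (==-true v w e))))
  ... | false = topplingsOf-∉ w vs (λ p → w∉ (there p))

  balance-untoppled : ∀ {c u} (s : Reaches m n c u) w → ¬ w ∈ trace s →
                      u w ≡ c w + neighbourTopplings w (trace s)
  balance-untoppled {c} {u} s w w∉ = begin
    u w                                               ≡⟨ +-identityʳ (u w) ⟨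
    u w + 0                                           ≡⟨ cong (λ z → u w + z) (*-zeroʳ (deg m n w)) ⟨
    u w + deg m n w * 0                               ≡⟨ cong (λ z → u w + deg m n w * z) (topplingsOf-∉ w (trace s) w∉) ⟨
    u w + deg m n w * topplingsOf w (trace s)         ≡⟨ balance s w ⟩
    c w + neighbourTopplings w (trace s)              ∎
    where open ≡-Reasoning

  toppledTops-∈ : ∀ i vs → inj₁ i ∈ vs → i ∈ toppledTops vs
  toppledTops-∈ i (inj₁ _ ∷ vs) (here refl) = here refl
  toppledTops-∈ i (inj₁ _ ∷ vs) (there p)   = there (toppledTops-∈ i vs p)
  toppledTops-∈ i (inj₂ _ ∷ vs) (there p)   = toppledTops-∈ i vs p

  toppledBottoms-∈ : ∀ j vs → inj₂ j ∈ vs → j ∈ toppledBottoms vs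
  toppledBottoms-∈ j (inj₂ _ ∷ vs) (here refl) = here refl
  toppledBottoms-∈ j (inj₁ _ ∷ vs) (there p)   = toppledBottoms-∈ j vs p
  toppledBottoms-∈ j (inj₂ _ ∷ vs) (there p)   = there (toppledBottoms-∈ j vs p)

  neighboursIn : (Vertex → Bool) → Vertex → ℕ
  neighboursIn P (inj₁ _) = count (λ j → P (inj₂ j)) (allFin n)
  neighboursIn P (inj₂ _) = count (λ i → P (inj₁ i)) (allFin (m ∸ 1))

  neighboursIn-≤ : ∀ P v vs → (∀ w → P w ≡ true → w ∈ v ∷ vs) →
                   neighboursIn P v ≤ neighbourTopplings v vs
  neighboursIn-≤ P (inj₁ i) vs covers =
    pigeonhole n _ (toppledBottoms vs) (λ j q → toppledBottoms-∈ j vs (notHead (covers (inj₂ j) q)))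
    where notHead : ∀ {j} → inj₂ j ∈ inj₁ i ∷ vs → inj₂ j ∈ vs
          notHead (there p) = p
  neighboursIn-≤ P (inj₂ k) vs covers =
    pigeonhole (m ∸ 1) _ (toppledTops vs) (λ j q → toppledTops-∈ j vs (notHead (covers (inj₁ j) q)))
    where notHead : ∀ {j} → inj₁ j ∈ inj₂ k ∷ vs → inj₁ j ∈ vs
          notHead (there p) = p

  _≟ᵥ_ : (v w : Vertex) → Dec (v ≡ w)
  _≟ᵥ_ = ≡-dec Fin._≟_ Fin._≟_

  open import Data.List.Membership.DecPropositional _≟ᵥ_ using (_∈?_)

  -- Take the vertex of P whose last toppling comes first: each of its
  -- neighbours in P topples afterwards and gives it a grain.
  dhar : ∀ {c u} (s : Reaches m n c u) (P : Vertex → Bool) → (∀ v → P v ≡ true → v ∈ trace s) →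
         ∀ v₀ → P v₀ ≡ true → Σ Vertex λ w → (P w ≡ true) × (neighboursIn P w ≤ u w)
  dhar ε P covers v₀ p₀ with covers v₀ p₀
  ... | ()
  dhar ((v , _ , _) ◅ s) P covers v₀ p₀ with P v in pv | v ∈? trace s
  ... | true  | no v∉ = v , pv , ≤-trans (neighboursIn-≤ P v (trace s) covers)
                                         (≤-trans (m≤n+m _ _) (≤-reflexive (sym (balance-untoppled s v v∉))))
  ... | true  | yes v∈ = dhar s P covers′ v₀ p₀
    where covers′ : ∀ w → P w ≡ true → w ∈ trace s
          covers′ w q with covers w q
          ... | here refl = v∈
          ... | there p   = p
  ... | false | _ = dhar s P covers′ v₀ p₀
    where covers′ : ∀ w → P w ≡ true → w ∈ trace s
          covers′ w q with covers w q
          ... | here refl = case (trans (sym pv) q) of λ ()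
          ... | there p   = p

  private
    notInEmpty : ∀ {A : Set} {x : A} (xs : List A) → length xs ≡ 0 → ¬ x ∈ xs
    notInEmpty [] _ ()

  -- If adding a nonzero d to u and stabilising returns u, then every vertex
  -- topples: a vertex that never topples received no grain from d nor from a
  -- neighbour, and this spreads through the connected graph D_{m,n}.
  every-vertex-topples : ∀ {M} → m ∸ 1 ≡ suc M → 1 ≤ n → (u d : Config m n) →
    (s : Reaches m n (λ w → u w + d w) u) → ∀ w₀ → 0 < d w₀ → ∀ w → w ∈ trace s
  every-vertex-topples {M} eM n≥1 u d s w₀ d>0 w with w ∈? trace s
  ... | yes w∈ = w∈
  ... | no  w∉ = ⊥-elim (<⇒≢ d>0 (sym (proj₁ (untoppled w₀ (noneToppled w w∉ w₀)))))
    where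
    vs : List Vertex
    vs = trace s
    untoppled : ∀ w → ¬ w ∈ vs → (d w ≡ 0) × (neighbourTopplings w vs ≡ 0)
    untoppled w w∉ = m+n≡0⇒m≡0 (d w) nothing , m+n≡0⇒n≡0 (d w) nothing
      where
      nothing : d w + neighbourTopplings w vs ≡ 0
      nothing = +-cancelˡ-≡ (u w) _ _
        (trans (sym (+-assoc (u w) _ _)) (trans (sym (balance-untoppled s w w∉)) (sym (+-identityʳ _))))
    i₀ : Fin (m ∸ 1)
    i₀ = subst Fin (sym eM) zero
    j₀ : Fin n
    j₀ = fromℕ< n≥1
    noBottoms : ∀ i → ¬ inj₁ i ∈ vs → ∀ j → ¬ inj₂ j ∈ vs
    noBottoms i i∉ j j∈ = notInEmpty _ (proj₂ (untoppled (inj₁ i) i∉)) (toppledBottoms-∈ j vs j∈)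
    noTops : ∀ j → ¬ inj₂ j ∈ vs → ∀ i → ¬ inj₁ i ∈ vs
    noTops j j∉ i i∈ = notInEmpty _ (proj₂ (untoppled (inj₂ j) j∉)) (toppledTops-∈ i vs i∈)
    noneToppled : ∀ w → ¬ w ∈ vs → ∀ w′ → ¬ w′ ∈ vs
    noneToppled (inj₁ i) i∉ (inj₂ j)  = noBottoms i i∉ j
    noneToppled (inj₁ i) i∉ (inj₁ i′) = noTops j₀ (noBottoms i i∉ j₀) i′
    noneToppled (inj₂ j) j∉ (inj₁ i)  = noTops j j∉ i
    noneToppled (inj₂ j) j∉ (inj₂ j′) = noBottoms i₀ (noTops j j∉ i₀) j′

-- The combinatorial content of recurrence (m ≥ 2, n ≥ 1): for k ≥ 1, if
-- l bottom vertices hold fewer than k grains, then fewer than k top vertices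
-- hold fewer than l grains.  Otherwise the set P of these top and bottom
-- vertices would violate Dhar's criterion, since every vertex topples.
recurrent-counting : ∀ m n {M} → m ∸ 1 ≡ suc M → 1 ≤ n → (u : Config m n) → Recurrent m n u →
  ∀ k → 1 ≤ k → below (below k (bottomHeights m n u)) (topHeights m n u) < k
recurrent-counting m n eM n≥1 u (_ , d , (w₀ , d>0) , s) k k≥1
  with k ≤? below (below k (bottomHeights m n u)) (topHeights m n u)
... | no  k≰ = ≰⇒> k≰
... | yes k≤ = ⊥-elim absurd
  where
  open Toppling m n
  l : ℕ
  l = below k (bottomHeights m n u)
  P : Vertex → Bool
  P (inj₁ i) = u (inj₁ i) <ᵇ l
  P (inj₂ j) = u (inj₂ j) <ᵇ k
  topsInP : below l (topHeights m n u) ≡ count (λ i → P (inj₁ i)) (allFin (m ∸ 1))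
  topsInP = count-map (λ h → h <ᵇ l) (λ i → u (inj₁ i)) (allFin (m ∸ 1))
  bottomsInP : l ≡ count (λ j → P (inj₂ j)) (allFin n)
  bottomsInP = count-map (λ h → h <ᵇ k) (λ j → u (inj₂ j)) (allFin n)
  someTop : Σ (Fin (m ∸ 1)) λ i → P (inj₁ i) ≡ true
  someTop = count-witness _ (allFin (m ∸ 1)) (≤-trans k≥1 (≤-trans k≤ (≤-reflexive topsInP)))
  absurd : ⊥
  absurd with dhar s P (λ v _ → every-vertex-topples eM n≥1 u d s w₀ d>0 v)
                 (inj₁ (proj₁ someTop)) (proj₂ someTop)
  ... | inj₁ i , inP , le = <⇒≱ (<ᵇ-true⇒< inP) (≤-trans (≤-reflexive bottomsInP) le)
  ... | inj₂ j , inP , le = <⇒≱ (<ᵇ-true⇒< inP) (≤-trans k≤ (≤-trans (≤-reflexive topsInP) le))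

north : ℕ → List Step → List Step
north zero    s = s
north (suc j) s = N ∷ north j s

pathThrough : ℕ → List ℕ → ℕ → List Step
pathThrough y []       top = north (top ∸ y) []
pathThrough y (h ∷ hs) top = north (h ∸ y) (E ∷ pathThrough h hs top)

eHeights-north : ∀ j y s → eHeightsFrom y (north j s) ≡ eHeightsFrom (j + y) s
eHeights-north zero    y s = refl
eHeights-north (suc j) y s = trans (eHeights-north j (suc y) s) (cong (λ z → eHeightsFrom z s) (+-suc j y))

eHeights-pathThrough : ∀ y hs top → Sorted (y ∷ hs) → eHeightsFrom y (pathThrough y hs top) ≡ hs
eHeights-pathThrough y []       top _         = eHeights-north (top ∸ y) y []
eHeights-pathThrough y (h ∷ hs) top (y≤h ∷ s) = begin
  eHeightsFrom y (north (h ∸ y) (E ∷ pathThrough h hs top))   ≡⟨ eHeights-north (h ∸ y) y _ ⟩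
  eHeightsFrom (h ∸ y + y) (E ∷ pathThrough h hs top)         ≡⟨ cong (λ z → z ∷ eHeightsFrom z (pathThrough h hs top)) (m∸n+n≡m y≤h) ⟩
  h ∷ eHeightsFrom h (pathThrough h hs top)                   ≡⟨ cong (h ∷_) (eHeights-pathThrough h hs top s) ⟩
  h ∷ hs                                                      ∎
  where open ≡-Reasoning

countE-north : ∀ j s → countE (north j s) ≡ countE s
countE-north zero    s = refl
countE-north (suc j) s = countE-north j s

countN-north : ∀ j s → countN (north j s) ≡ j + countN s
countN-north zero    s = refl
countN-north (suc j) s = cong suc (countN-north j s)

countE-pathThrough : ∀ y hs top → countE (pathThrough y hs top) ≡ length hs
countE-pathThrough y []       top = countE-north (top ∸ y) []
countE-pathThrough y (h ∷ hs) top = trans (countE-north (h ∸ y) _) (cong suc (countE-pathThrough h hs top))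

countN-pathThrough : ∀ y hs top → Sorted (y ∷ hs) → All (_≤ top) hs → y ≤ top →
                     countN (pathThrough y hs top) + y ≡ top
countN-pathThrough y [] top _ _ y≤top =
  trans (cong (_+ y) (trans (countN-north (top ∸ y) []) (+-identityʳ _))) (m∸n+n≡m y≤top)
countN-pathThrough y (h ∷ hs) top (y≤h ∷ s) (h≤top ∷ hs≤top) _ = begin
  countN (north (h ∸ y) (E ∷ rest)) + y      ≡⟨ cong (_+ y) (countN-north (h ∸ y) (E ∷ rest)) ⟩
  h ∸ y + countN rest + y                    ≡⟨ swap-last (h ∸ y) (countN rest) y ⟩
  h ∸ y + y + countN rest                    ≡⟨ cong (_+ countN rest) (m∸n+n≡m y≤h) ⟩
  h + countN rest                            ≡⟨ +-comm h (countN rest) ⟩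
  countN rest + h                            ≡⟨ countN-pathThrough h hs top s hs≤top h≤top ⟩
  top                                        ∎
  where
  open ≡-Reasoning
  rest : List Step
  rest = pathThrough h hs top
  swap-last : ∀ a b c → a + b + c ≡ a + c + b
  swap-last = solve-∀

points-north : ∀ j x y s {q : ℕ × ℕ} → q ∈ pointsFrom x y (north j s) →
  (proj₁ q ≡ x × y ≤ proj₂ q × proj₂ q ≤ j + y) ⊎ q ∈ pointsFrom x (j + y) s
points-north zero    x y s p           = inj₂ p
points-north (suc j) x y s (here refl) = inj₁ (refl , ≤-refl , m≤n+m y (suc j))
points-north (suc j) x y s {q} (there p) with points-north j x (suc y) s p
... | inj₁ (e , y<py , py≤) = inj₁ (e , <⇒≤ y<py , ≤-trans py≤ (≤-reflexive (+-suc j y)))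
... | inj₂ r = inj₂ (subst (λ z → q ∈ pointsFrom x z s) (+-suc j y) r)

-- Column line x₀ + t is reached after t east steps, so the path meets it
-- between the heights of the t-th and (t+1)-st east steps.
record PathPoint (x₀ y₀ : ℕ) (hs : List ℕ) (top px py : ℕ) : Set where
  field
    right-of-start : x₀ ≤ px
    left-of-end    : px ≤ x₀ + length hs
    below-top      : py ≤ top
    above-previous : ∀ t → px ≡ x₀ + suc t → nth hs t ≤ py
    below-next     : ∀ t → px ≡ x₀ + t → t < length hs → py ≤ nth hs t
    above-start    : px ≡ x₀ → y₀ ≤ py

private
  x≢x+suc : ∀ x t → ¬ x ≡ x + suc t
  x≢x+suc x t e = m≢1+n+m x (trans e (trans (+-suc x t) (cong suc (+-comm x t))))

  start-column : ∀ x₀ {y₀} hs {top py} → y₀ ≤ py → py ≤ top → (0 < length hs → py ≤ nth hs 0) →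
                 PathPoint x₀ y₀ hs top x₀ py
  start-column x₀ hs y₀≤py py≤top py≤first = record
    { right-of-start = ≤-refl
    ; left-of-end    = m≤m+n x₀ _
    ; below-top      = py≤top
    ; above-previous = λ t e → ⊥-elim (x≢x+suc x₀ t e)
    ; below-next     = λ { zero _ 0<len → py≤first 0<len ; (suc t) e _ → ⊥-elim (x≢x+suc x₀ t e) }
    ; above-start    = λ _ → y₀≤py }

  later-column : ∀ x₀ {y₀ h} hs {top px py} → PathPoint (suc x₀) h hs top px py →
                 PathPoint x₀ y₀ (h ∷ hs) top px py
  later-column x₀ hs r = record
    { right-of-start = ≤-trans (n≤1+n x₀) right-of-start
    ; left-of-end    = ≤-trans left-of-end (≤-reflexive (sym (+-suc x₀ (length hs))))
    ; below-top      = below-top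
    ; above-previous = λ { zero e → above-start (trans e (trans (+-suc x₀ 0) (cong suc (+-identityʳ x₀))))
                         ; (suc t) e → above-previous t (trans e (+-suc x₀ (suc t))) }
    ; below-next     = λ { zero e _ → ⊥-elim (<-irrefl refl (≤-trans right-of-start (≤-reflexive (trans e (+-identityʳ x₀)))))
                         ; (suc t) e (s≤s t<len) → below-next t (trans e (+-suc x₀ t)) t<len }
    ; above-start    = λ e → ⊥-elim (<-irrefl refl (≤-trans right-of-start (≤-reflexive e))) }
    where open PathPoint r

points-pathThrough : ∀ x₀ y₀ hs top → Sorted (y₀ ∷ hs) → All (_≤ top) hs → y₀ ≤ top →
  ∀ px py → (px , py) ∈ pointsFrom x₀ y₀ (pathThrough y₀ hs top) → PathPoint x₀ y₀ hs top px py
points-pathThrough x₀ y₀ [] top _ _ y₀≤top px py p with points-north (top ∸ y₀) x₀ y₀ [] p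
... | inj₁ (refl , y₀≤py , py≤) = start-column x₀ [] y₀≤py (≤-trans py≤ (≤-reflexive (m∸n+n≡m y₀≤top))) (λ ())
... | inj₂ (here refl) = start-column x₀ [] (m≤n+m y₀ _) (≤-reflexive (m∸n+n≡m y₀≤top)) (λ ())
points-pathThrough x₀ y₀ (h ∷ hs) top (y₀≤h ∷ s) (h≤top ∷ hs≤top) _ px py p
  with points-north (h ∸ y₀) x₀ y₀ _ p
... | inj₁ (refl , y₀≤py , py≤) = start-column x₀ (h ∷ hs) y₀≤py (≤-trans py≤h h≤top) (λ _ → py≤h)
  where py≤h : py ≤ h
        py≤h = ≤-trans py≤ (≤-reflexive (m∸n+n≡m y₀≤h))
... | inj₂ (here refl) = start-column x₀ (h ∷ hs) (m≤n+m y₀ _) (≤-trans py≤h h≤top) (λ _ → py≤h)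
  where py≤h : h ∸ y₀ + y₀ ≤ h
        py≤h = ≤-reflexive (m∸n+n≡m y₀≤h)
... | inj₂ (there q) = later-column x₀ hs (points-pathThrough (suc x₀) h hs top s hs≤top h≤top px py q′)
  where q′ : (px , py) ∈ pointsFrom (suc x₀) h (pathThrough h hs top)
        q′ = subst (λ z → (px , py) ∈ pointsFrom (suc x₀) z (pathThrough h hs top)) (m∸n+n≡m y₀≤h) q

-- With a and b the
-- sorted top and bottom heights, column x < m of f(u) is the interval
-- lo x ≤ y < hi x, where hi x is the height of column x of the first Young
-- diagram and lo x = #{j : b_j < x} is where the second diagram starts.
module Shape (m n : ℕ) (m≥1 : 1 ≤ m) (n≥1 : 1 ≤ n) (u : Config m n) (stable : Stable m n u) where

  a : List ℕ
  a = sortedTop m n u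

  b : List ℕ
  b = sortedBottom m n u

  hi : ℕ → ℕ
  hi = colHeight m n u

  lo : ℕ → ℕ
  lo x = below x b

  a-length : length a ≡ m ∸ 1
  a-length = trans (↭-length (sort-↭ (topHeights m n u)))
               (trans (length-map _ (allFin (m ∸ 1))) (length-tabulate {n = m ∸ 1} id))

  b-length : length b ≡ n
  b-length = trans (↭-length (sort-↭ (bottomHeights m n u)))
               (trans (length-map _ (allFin n)) (length-tabulate {n = n} id))

  a-sorted : Sorted a
  a-sorted = sort-↗ (topHeights m n u)

  b-sorted : Sorted b
  b-sorted = sort-↗ (bottomHeights m n u)

  a<n : All (_< n) a
  a<n = All-resp-↭ (↭-sym (sort-↭ (topHeights m n u))) (map⁺ (tabulate⁺ (λ i → stable (inj₁ i))))

  b<m : All (_< m) b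
  b<m = All-resp-↭ (↭-sym (sort-↭ (bottomHeights m n u))) (map⁺ (tabulate⁺ (λ j → stable (inj₂ j))))

  hi-inner : ∀ x → suc x < m → hi x ≡ suc (nth a x)
  hi-inner x p with suc x ≟ m
  ... | yes e = ⊥-elim (<-irrefl e p)
  ... | no  _ = refl

  hi-last : ∀ x → suc x ≡ m → hi x ≡ n
  hi-last x p with suc x ≟ m
  ... | yes _ = refl
  ... | no  q = ⊥-elim (q p)

  inner<a-length : ∀ x → suc x < m → x < length a
  inner<a-length x p = subst (x <_) (sym a-length) (∸-monoˡ-≤ 1 p)

  hi≤n : ∀ x → x < m → hi x ≤ n
  hi≤n x p with m≤n⇒m<n∨m≡n p
  ... | inj₁ q = subst (_≤ n) (sym (hi-inner x q)) (All-nth a<n x (inner<a-length x q))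
  ... | inj₂ q = ≤-reflexive (hi-last x q)

  hi≥1 : ∀ x → x < m → 1 ≤ hi x
  hi≥1 x p with m≤n⇒m<n∨m≡n p
  ... | inj₁ q = subst (1 ≤_) (sym (hi-inner x q)) (s≤s z≤n)
  ... | inj₂ q = subst (1 ≤_) (sym (hi-last x q)) n≥1

  hi-mono : ∀ x → suc x < m → hi x ≤ hi (suc x)
  hi-mono x p with m≤n⇒m<n∨m≡n p
  ... | inj₁ q = subst₂ _≤_ (sym (hi-inner x p)) (sym (hi-inner (suc x) q))
                   (s≤s (nth-mono a-sorted x (inner<a-length (suc x) q)))
  ... | inj₂ q = subst₂ _≤_ (sym (hi-inner x p)) (sym (hi-last (suc x) q))
                   (All-nth a<n x (inner<a-length x p))

  lo≤n : ∀ x → lo x ≤ n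
  lo≤n x = subst (lo x ≤_) b-length (below-length x b)

  -- Cells of f(u): (x , y) ∈ f(u) iff x < m and lo x ≤ y < hi x.
  -- (Row y of the second diagram has width 1 + b_y, and x ≤ b_y iff lo x ≤ y.)
  f-cell→ : ∀ x y → f m n u x y ≡ true → (x < m) × (lo x ≤ y) × (y < hi x)
  f-cell→ x y e with suc x ≤? m | suc y ≤? hi x | suc y ≤? n | suc x ≤? rowWidth m n u y
  ... | yes x<m | yes y<hi | yes y<n | yes (s≤s x≤b) =
        x<m , Equivalence.to (below-≤⇔ b-sorted x y (subst (y <_) (sym b-length) y<n)) x≤b , y<hi
  ... | no  _ | _     | _     | _     = case e of λ ()
  ... | yes _ | no  _ | _     | _     = case e of λ ()
  ... | yes _ | yes _ | no  _ | _     = case e of λ ()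
  ... | yes _ | yes _ | yes _ | no  _ = case e of λ ()

  f-cell← : ∀ x y → x < m → lo x ≤ y → y < hi x → f m n u x y ≡ true
  f-cell← x y x<m lo≤y y<hi with suc x ≤? m | suc y ≤? hi x | suc y ≤? n | suc x ≤? rowWidth m n u y
  ... | yes _ | yes _ | yes _   | yes _ = refl
  ... | no  q | _     | _       | _     = ⊥-elim (q x<m)
  ... | yes _ | no  q | _       | _     = ⊥-elim (q y<hi)
  ... | yes _ | yes _ | no  q   | _     = ⊥-elim (q (≤-trans y<hi (hi≤n x x<m)))
  ... | yes _ | yes _ | yes y<n | no  q =
        ⊥-elim (q (s≤s (Equivalence.from (below-≤⇔ b-sorted x y (subst (y <_) (sym b-length) y<n)) lo≤y)))

  private
    atLeastTwo : ∀ {x k} → suc x < k → k ∸ 1 ≡ suc (k ∸ 2)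
    atLeastTwo {k = suc (suc k)} _       = refl
    atLeastTwo {k = suc zero}    (s≤s ())

  module _ (recurrent : Recurrent m n u) where

    -- Consecutive columns of f(u) share a cell: the geometric form of
    -- recurrent-counting (with k = x + 1).
    lo<hi : ∀ x → suc x < m → lo (suc x) < hi x
    lo<hi x x+1<m = subst (lo (suc x) <_) (sym (hi-inner x x+1<m)) (s≤s lo≤a)
      where
      lo-unsorted : lo (suc x) ≡ below (suc x) (bottomHeights m n u)
      lo-unsorted = count-↭ _ (sort-↭ (bottomHeights m n u))
      counted : below (lo (suc x)) a < suc x
      counted = subst (_< suc x)
        (trans (cong (λ l → below l (topHeights m n u)) (sym lo-unsorted)) (sym (count-↭ _ (sort-↭ _))))
        (recurrent-counting m n (atLeastTwo x+1<m) n≥1 u recurrent (suc x) (s≤s z≤n))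
      lo≤a : lo (suc x) ≤ nth a x
      lo≤a = Equivalence.from (below-≤⇔ a-sorted (lo (suc x)) x (inner<a-length x x+1<m)) (s≤s⁻¹ counted)

    lo≤hi : ∀ x → x < m → lo x ≤ hi x
    lo≤hi zero    _     = subst (_≤ hi 0) (sym (below-zero b)) z≤n
    lo≤hi (suc x) x+1<m = ≤-trans (<⇒≤ (lo<hi x x+1<m)) (hi-mono x x+1<m)

    -- The boundary paths of f(u): the upper path has its east steps at the
    -- heights hi x, the lower path at the heights lo x.
    upperHeights lowerHeights : List ℕ
    upperHeights = applyUpTo hi m
    lowerHeights = applyUpTo lo m

    upper lower : List Step
    upper = pathThrough 1 upperHeights n
    lower = pathThrough 0 lowerHeights n

    upperHeights-sorted : Sorted (1 ∷ upperHeights)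
    upperHeights-sorted = applyUpTo-sorted hi m 1 (hi≥1 0) hi-mono

    lowerHeights-sorted : Sorted (0 ∷ lowerHeights)
    lowerHeights-sorted = applyUpTo-sorted lo m 0 (λ _ → z≤n) (λ t _ → below-mono t b)

    upperHeights≤n : All (_≤ n) upperHeights
    upperHeights≤n = applyUpTo⁺₁ hi m (λ {x} x<m → hi≤n x x<m)

    lowerHeights≤n : All (_≤ n) lowerHeights
    lowerHeights≤n = applyUpTo⁺₁ lo m (λ {x} _ → lo≤n x)

    upper-isPath : IsPath m n (N ∷ upper)
    upper-isPath = trans (countE-pathThrough 1 upperHeights n) (length-applyUpTo hi m)
                 , trans (+-comm 1 _) (countN-pathThrough 1 upperHeights n upperHeights-sorted upperHeights≤n n≥1)

    lower-isPath : IsPath m n lower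
    lower-isPath = trans (countE-pathThrough 0 lowerHeights n) (length-applyUpTo lo m)
                 , trans (sym (+-identityʳ _)) (countN-pathThrough 0 lowerHeights n lowerHeights-sorted lowerHeights≤n z≤n)

    upper-heights : ∀ x → x < m → nth (eHeightsFrom 0 (N ∷ upper)) x ≡ hi x
    upper-heights x x<m =
      trans (cong (λ l → nth l x) (eHeights-pathThrough 1 upperHeights n upperHeights-sorted)) (nth-applyUpTo hi m x x<m)

    lower-heights : ∀ x → x < m → nth (eHeightsFrom 0 lower) x ≡ lo x
    lower-heights x x<m =
      trans (cong (λ l → nth l x) (eHeights-pathThrough 0 lowerHeights n lowerHeights-sorted)) (nth-applyUpTo lo m x x<m)

    -- The two paths meet only at (0 , 0) and (m , n): on column line 0 the
    -- lower path stays at height lo 0 = 0, on an inner line x + 1 the upper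
    -- path is at least hi x while the lower one is at most lo (x + 1) < hi x,
    -- and on line m the upper path is at height hi (m - 1) = n.
    paths-meet-at-ends : ∀ q → q ∈ pointsFrom 0 0 (N ∷ upper) → q ∈ pointsFrom 0 0 lower →
                         (q ≡ (0 , 0)) ⊎ (q ≡ (m , n))
    paths-meet-at-ends q (here refl) _ = inj₁ refl
    paths-meet-at-ends (px , py) (there onUpper) onLower = onLine px refl
      where
      U : PathPoint 0 1 upperHeights n px py
      U = points-pathThrough 0 1 upperHeights n upperHeights-sorted upperHeights≤n n≥1 px py onUpper
      L : PathPoint 0 0 lowerHeights n px py
      L = points-pathThrough 0 0 lowerHeights n lowerHeights-sorted lowerHeights≤n z≤n px py onLower
      lowerLength : length lowerHeights ≡ m
      lowerLength = length-applyUpTo lo m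
      onLine : ∀ t → px ≡ t → ((px , py) ≡ (0 , 0)) ⊎ ((px , py) ≡ (m , n))
      onLine zero e = inj₁ (cong₂ _,_ e (n≤0⇒n≡0 py≤0))
        where
        py≤0 : py ≤ 0
        py≤0 = subst (py ≤_) (trans (nth-applyUpTo lo m 0 m≥1) (below-zero b))
                 (PathPoint.below-next L 0 e (subst (0 <_) (sym lowerLength) m≥1))
      onLine (suc t) e with m≤n⇒m<n∨m≡n (subst (_≤ m) e (subst (px ≤_) lowerLength (PathPoint.left-of-end L)))
      ... | inj₁ t+1<m = ⊥-elim (<⇒≱ (lo<hi t t+1<m) (≤-trans hi≤py py≤lo))
        where
        hi≤py : hi t ≤ py
        hi≤py = subst (_≤ py) (nth-applyUpTo hi m t (<-trans (n<1+n t) t+1<m)) (PathPoint.above-previous U t e)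
        py≤lo : py ≤ lo (suc t)
        py≤lo = subst (py ≤_) (nth-applyUpTo lo m (suc t) t+1<m)
                  (PathPoint.below-next L (suc t) e (subst (suc t <_) (sym lowerLength) t+1<m))
      ... | inj₂ t+1≡m = inj₂ (cong₂ _,_ (trans e t+1≡m) (≤-antisym (PathPoint.below-top L) n≤py))
        where
        n≤py : n ≤ py
        n≤py = subst (_≤ py) (trans (nth-applyUpTo hi m t (subst (t <_) t+1≡m ≤-refl)) (hi-last t t+1≡m))
                 (PathPoint.above-previous U t e)

    f-parallelogram : ParallelogramPolyomino m n (f m n u)
    f-parallelogram = upper , lower , upper-isPath , lower-isPath , paths-meet-at-ends , cells
      where
      cells : ∀ x y → (f m n u x y ≡ true) ⇔
              ((x < m) × (nth (eHeightsFrom 0 lower) x ≤ y) × (y < nth (eHeightsFrom 0 (N ∷ upper)) x))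
      cells x y = mk⇔
        (λ e → let (x<m , lo≤y , y<hi) = f-cell→ x y e
               in x<m , subst (_≤ y) (sym (lower-heights x x<m)) lo≤y , subst (y <_) (sym (upper-heights x x<m)) y<hi)
        (λ (x<m , lo≤y , y<hi) →
               f-cell← x y x<m (subst (_≤ y) (lower-heights x x<m) lo≤y) (subst (y <_) (upper-heights x x<m) y<hi))

    column-size : ∀ x → x < m → sumUpTo n (λ y → indicator (f m n u x y)) ≡ hi x ∸ lo x
    column-size x x<m = sumUpTo-interval n (lo x) (hi x) (lo≤hi x x<m) (hi≤n x x<m) _ split
      where
      notCell : ∀ y → ¬ (lo x ≤ y × y < hi x) → f m n u x y ≡ false
      notCell y out with f m n u x y in e
      ... | true  = ⊥-elim (out (proj₂ (f-cell→ x y e)))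
      ... | false = refl
      byValues : ∀ {c d e} c′ d′ e′ → c ≡ c′ → d ≡ d′ → e ≡ e′ →
                 indicator c′ + indicator d′ ≡ indicator e′ → indicator c + indicator d ≡ indicator e
      byValues _ _ _ refl refl refl eq = eq
      split : ∀ y → y < n → indicator (f m n u x y) + indicator (y <ᵇ lo x) ≡ indicator (y <ᵇ hi x)
      split y _ = byCases (y <? lo x) (y <? hi x)
        where
        goal : Set
        goal = indicator (f m n u x y) + indicator (y <ᵇ lo x) ≡ indicator (y <ᵇ hi x)
        byCases : Dec (y < lo x) → Dec (y < hi x) → goal
        byCases (yes y<lo) _ = byValues false true true (notCell y (λ (lo≤y , _) → <⇒≱ y<lo lo≤y))
                                 (<⇒<ᵇ-true y<lo) (<⇒<ᵇ-true (<-≤-trans y<lo (lo≤hi x x<m))) refl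
        byCases (no y≮lo) (yes y<hi) = byValues true false true (f-cell← x y x<m (≮⇒≥ y≮lo) y<hi)
                                         (≥⇒<ᵇ-false (≮⇒≥ y≮lo)) (<⇒<ᵇ-true y<hi) refl
        byCases (no y≮lo) (no y≮hi) = byValues false false false (notCell y (λ (_ , y<hi) → y≮hi y<hi))
                                        (≥⇒<ᵇ-false (≮⇒≥ y≮lo)) (≥⇒<ᵇ-false (≮⇒≥ y≮hi)) refl

    area : areaIn m n (f m n u) ≡ sumUpTo m (λ x → hi x ∸ lo x)
    area = trans (sum-allFin m (λ x → sum (map (λ y → indicator (f m n u x (toℕ y))) (allFin n))))
                 (sumUpTo-cong m (λ x x<m → trans (sum-allFin n (λ y → indicator (f m n u x y))) (column-size x x<m)))

    private
      m-1+1 : suc (m ∸ 1) ≡ m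
      m-1+1 = trans (+-comm 1 (m ∸ 1)) (m∸n+n≡m m≥1)

    -- Since consecutive columns overlap, the first k + 1 columns
    -- contain at least k + hi k cells.
    columns-lower-bound : ∀ k → k < m → k + hi k ≤ sumUpTo (suc k) (λ x → hi x ∸ lo x)
    columns-lower-bound zero    _     = ≤-reflexive (trans (cong (hi 0 ∸_) (sym (below-zero b))) (sym (+-identityʳ _)))
    columns-lower-bound (suc k) k+1<m = begin
      suc k + hi (suc k)                                ≡⟨ cong (λ z → suc k + z) (m∸n+n≡m (lo≤hi (suc k) k+1<m)) ⟨
      suc k + (hi (suc k) ∸ lo (suc k) + lo (suc k))    ≡⟨ regroup k (hi (suc k) ∸ lo (suc k)) (lo (suc k)) ⟩
      k + suc (lo (suc k)) + (hi (suc k) ∸ lo (suc k))  ≤⟨ +-monoˡ-≤ _ (+-monoʳ-≤ k (lo<hi k k+1<m)) ⟩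
      k + hi k + (hi (suc k) ∸ lo (suc k))              ≤⟨ +-monoˡ-≤ _ (columns-lower-bound k (<-trans (n<1+n k) k+1<m)) ⟩
      sumUpTo (suc k) (λ x → hi x ∸ lo x) + (hi (suc k) ∸ lo (suc k))
                                                        ≡⟨ sumUpTo-snoc (suc k) (λ x → hi x ∸ lo x) ⟨
      sumUpTo (suc (suc k)) (λ x → hi x ∸ lo x)         ∎
      where
      open ≤-Reasoning
      regroup : ∀ k d l → suc k + (d + l) ≡ k + suc l + d
      regroup = solve-∀

    area-lower-bound : m ∸ 1 + n ≤ areaIn m n (f m n u)
    area-lower-bound = subst₂ _≤_ (cong (λ z → m ∸ 1 + z) (hi-last (m ∸ 1) m-1+1))
      (trans (cong (λ k → sumUpTo k (λ x → hi x ∸ lo x)) m-1+1) (sym area))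
      (columns-lower-bound (m ∸ 1) (subst (m ∸ 1 <_) m-1+1 ≤-refl))

    sum-hi : sumUpTo m hi ≡ m ∸ 1 + sum a + n
    sum-hi = begin
      sumUpTo m hi                                 ≡⟨ cong (λ k → sumUpTo k hi) m-1+1 ⟨
      sumUpTo (suc (m ∸ 1)) hi                     ≡⟨ sumUpTo-snoc (m ∸ 1) hi ⟩
      sumUpTo (m ∸ 1) hi + hi (m ∸ 1)              ≡⟨ cong₂ _+_ (sumUpTo-cong (m ∸ 1) inner) (hi-last (m ∸ 1) m-1+1) ⟩
      sumUpTo (m ∸ 1) (λ x → 1 + nth a x) + n      ≡⟨ cong (_+ n) (sumUpTo-+ (m ∸ 1) (λ _ → 1) (nth a)) ⟩
      sumUpTo (m ∸ 1) (λ _ → 1) + sumUpTo (m ∸ 1) (nth a) + n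
                                                   ≡⟨ cong₂ (λ p q → p + q + n) (trans (sumUpTo-const (m ∸ 1) 1) (*-identityʳ _)) sum-a ⟩
      m ∸ 1 + sum a + n                            ∎
      where
      open ≡-Reasoning
      inner : ∀ x → x < m ∸ 1 → hi x ≡ 1 + nth a x
      inner x x<m-1 = hi-inner x (subst (suc x <_) m-1+1 (s≤s x<m-1))
      sum-a : sumUpTo (m ∸ 1) (nth a) ≡ sum a
      sum-a = trans (cong (λ k → sumUpTo k (nth a)) (sym a-length)) (sum-nth a)

    area-identity : areaIn m n (f m n u) + n * (m ∸ 1) ≡
                    (m ∸ 1 + n) + (sum (topHeights m n u) + sum (bottomHeights m n u))
    area-identity = begin
      areaIn m n (f m n u) + n * (m ∸ 1)
        ≡⟨ cong₂ _+_ area (sym (trans (sumUpTo-below m b b<m) (cong (_* (m ∸ 1)) b-length))) ⟩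
      sumUpTo m (λ x → hi x ∸ lo x) + (sumUpTo m lo + sum b)
        ≡⟨ +-assoc (sumUpTo m (λ x → hi x ∸ lo x)) _ _ ⟨
      sumUpTo m (λ x → hi x ∸ lo x) + sumUpTo m lo + sum b
        ≡⟨ cong (_+ sum b) (sumUpTo-+ m (λ x → hi x ∸ lo x) lo) ⟨
      sumUpTo m (λ x → hi x ∸ lo x + lo x) + sum b
        ≡⟨ cong (_+ sum b) (trans (sumUpTo-cong m (λ x x<m → m∸n+n≡m (lo≤hi x x<m))) sum-hi) ⟩
      m ∸ 1 + sum a + n + sum b
        ≡⟨ regroup (m ∸ 1) (sum a) n (sum b) ⟩
      (m ∸ 1 + n) + (sum a + sum b)
        ≡⟨ cong (λ z → m ∸ 1 + n + z) (cong₂ _+_ (sum-↭ (sort-↭ (topHeights m n u))) (sum-↭ (sort-↭ (bottomHeights m n u)))) ⟩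
      (m ∸ 1 + n) + (sum (topHeights m n u) + sum (bottomHeights m n u))
        ∎
      where
      open ≡-Reasoning
      regroup : ∀ p q r s → p + q + r + s ≡ (p + r) + (q + s)
      regroup = solve-∀

    minimal-area⇔ : (areaIn m n (f m n u) ≡ m + n ∸ 1) ⇔
                    (sum (topHeights m n u) + sum (bottomHeights m n u) ≡ n * (m ∸ 1))
    minimal-area⇔ = mk⇔
      (λ e → sym (+-cancelˡ-≡ (m ∸ 1 + n) _ _ (trans (cong (_+ n * (m ∸ 1)) (sym (trans e m+n-1))) area-identity)))
      (λ e → trans (+-cancelʳ-≡ (n * (m ∸ 1)) _ _ (trans area-identity (cong (λ z → m ∸ 1 + n + z) e))) (sym m+n-1))
      where
      m+n-1 : m + n ∸ 1 ≡ m ∸ 1 + n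
      m+n-1 = +-∸-comm n m≥1

    heights-lower-bound : n * (m ∸ 1) ≤ sum (topHeights m n u) + sum (bottomHeights m n u)
    heights-lower-bound = +-cancelˡ-≤ (m ∸ 1 + n) _ _
      (subst (m ∸ 1 + n + n * (m ∸ 1) ≤_) area-identity (+-monoˡ-≤ (n * (m ∸ 1)) area-lower-bound))

level≡0⇔ : ∀ m n (u : Config m n) →
  (level m n u ≡ + 0) ⇔ (sum (topHeights m n u) + sum (bottomHeights m n u) ≡ n * (m ∸ 1))
level≡0⇔ m n u = mk⇔ (λ e → ℤ+-injective (i-j≡0⇒i≡j _ _ e)) (λ e → i≡j⇒i-j≡0 (cong (ℤ.+_) e))

level-nonneg : ∀ m n (u : Config m n) →
  n * (m ∸ 1) ≤ sum (topHeights m n u) + sum (bottomHeights m n u) → + 0 ℤ.≤ level m n u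
level-nonneg m n u le =
  subst (+ 0 ℤ.≤_) (sym (trans ([+m]-[+n]≡m⊖n (sum (topHeights m n u) + sum (bottomHeights m n u)) (n * (m ∸ 1))) (⊖-≥ le))) (ℤ.+≤+ z≤n)

recurrent-level-nonneg : ∀ m n → 1 ≤ m → 1 ≤ n → (u : Config m n) → Recurrent m n u → + 0 ℤ.≤ level m n u
recurrent-level-nonneg m n m≥1 n≥1 u rec =
  level-nonneg m n u (Shape.heights-lower-bound m n m≥1 n≥1 u (proj₁ rec) rec)

ribbon⇔level-zero : ∀ m n → 1 ≤ m → 1 ≤ n → (u : Config m n) → Recurrent m n u →
                    Ribbon m n (f m n u) ⇔ (level m n u ≡ + 0)
ribbon⇔level-zero m n m≥1 n≥1 u rec = mk⇔
  (λ (_ , minimal) → Equivalence.from (level≡0⇔ m n u) (Equivalence.to (minimal-area⇔ rec) minimal))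
  (λ level0 → f-parallelogram rec , Equivalence.from (minimal-area⇔ rec) (Equivalence.to (level≡0⇔ m n u) level0))
  where open Shape m n m≥1 n≥1 u (proj₁ rec)

-- A recurrent configuration of level 0 on D_{M+1,Q+1}: every top vertex
-- holds n - 1 = Q grains, the bottom vertex v_m holds m - 1 = M grains and
-- the other bottom vertices are empty.  Adding one grain to every bottom
-- vertex, v_m topples, then each top vertex in turn, then each remaining
-- bottom vertex, and the configuration comes back.
module LevelZero (M Q : ℕ) where

  private
    m n : ℕ
    m = suc M
    n = suc Q

    if-cong : ∀ {b b′ : Bool} (x y : ℕ) → b ≡ b′ → (if b then x else y) ≡ (if b′ then x else y)
    if-cong x y refl = refl

    <ᵇ-suc : ∀ x p → ¬ x ≡ p → (x <ᵇ suc p) ≡ (x <ᵇ p)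
    <ᵇ-suc x p x≢p with <-cmp x p
    ... | tri< x<p _ _ = trans (<⇒<ᵇ-true (m<n⇒m<1+n x<p)) (sym (<⇒<ᵇ-true x<p))
    ... | tri≈ _ x≡p _ = ⊥-elim (x≢p x≡p)
    ... | tri> _ _ x>p = trans (≥⇒<ᵇ-false x>p) (sym (≥⇒<ᵇ-false (<⇒≤ x>p)))

  -- The intermediate configurations: tops v_1, …, v_p have toppled (holding
  -- q grains), the others are full (n grains); bottom v_m holds p grains,
  -- bottoms v_{m+1}, …, v_{m+q} have toppled and the others hold p + 1.
  stage : ℕ → ℕ → Config m n
  stage p q (inj₁ i)       = if toℕ i <ᵇ p then q else n
  stage p q (inj₂ zero)    = p
  stage p q (inj₂ (suc j)) = if toℕ j <ᵇ q then 0 else suc p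

  topple-top : ∀ p → (p<M : p < M) → LegalStep m n (stage p 0) (stage (suc p) 0)
  topple-top p p<M = inj₁ i , ≤-reflexive (sym full) , agrees
    where
    i : Fin M
    i = fromℕ< p<M
    i≡p : toℕ i ≡ p
    i≡p = toℕ-fromℕ< p<M
    full : stage p 0 (inj₁ i) ≡ n
    full = if-cong 0 n (trans (cong (_<ᵇ p) i≡p) (≥⇒<ᵇ-false {p} ≤-refl))
    agrees : ∀ w → stage (suc p) 0 w ≡ topple m n (stage p 0) (inj₁ i) w
    agrees (inj₁ j) with eqFin i j in e
    ... | true with eqFin-true e
    ...   | refl = trans (if-cong 0 n (trans (cong (_<ᵇ suc p) i≡p) (<⇒<ᵇ-true {p} ≤-refl)))
                           (sym (trans (cong (_∸ n) full) (n∸n≡0 n)))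
    agrees (inj₁ j) | false = if-cong 0 n (<ᵇ-suc (toℕ j) p (λ j≡p → eqFin-false e (toℕ-injective (trans i≡p (sym j≡p)))))
    agrees (inj₂ zero)    = refl
    agrees (inj₂ (suc j)) = refl

  topple-bottom : ∀ q → (q<Q : q < Q) → LegalStep m n (stage M q) (stage M (suc q))
  topple-bottom q q<Q = inj₂ (suc j) , ≤-reflexive (sym full) , agrees
    where
    j : Fin Q
    j = fromℕ< q<Q
    j≡q : toℕ j ≡ q
    j≡q = toℕ-fromℕ< q<Q
    full : stage M q (inj₂ (suc j)) ≡ m
    full = if-cong 0 m (trans (cong (_<ᵇ q) j≡q) (≥⇒<ᵇ-false {q} ≤-refl))
    toppledTop : ∀ i → (toℕ i <ᵇ M) ≡ true
    toppledTop i = <⇒<ᵇ-true (toℕ<n i)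
    agrees : ∀ w → stage M (suc q) w ≡ topple m n (stage M q) (inj₂ (suc j)) w
    agrees (inj₁ i)    = trans (if-cong (suc q) n (toppledTop i)) (sym (cong suc (if-cong q n (toppledTop i))))
    agrees (inj₂ zero) = refl
    agrees (inj₂ (suc k)) with eqFin (suc j) (suc k) in e
    ... | true with eqFin-true e
    ...   | refl = trans (if-cong 0 m (trans (cong (_<ᵇ suc q) j≡q) (<⇒<ᵇ-true {q} ≤-refl)))
                           (sym (trans (cong (_∸ m) full) (n∸n≡0 m)))
    agrees (inj₂ (suc k)) | false = if-cong 0 m (<ᵇ-suc (toℕ k) q (λ k≡q → eqFin-false e (cong suc (toℕ-injective (trans j≡q (sym k≡q))))))

  topple-tops : ∀ k p → k + p ≡ M → Reaches m n (stage p 0) (stage M 0)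
  topple-tops zero    p e = subst (λ z → Reaches m n (stage z 0) (stage M 0)) (sym e) ε
  topple-tops (suc k) p e = topple-top p (subst (p <_) e (s≤s (m≤n+m p k))) ◅ topple-tops k (suc p) (trans (+-suc k p) e)

  topple-bottoms : ∀ k q → k + q ≡ Q → Reaches m n (stage M q) (stage M Q)
  topple-bottoms zero    q e = subst (λ z → Reaches m n (stage M z) (stage M Q)) (sym e) ε
  topple-bottoms (suc k) q e = topple-bottom q (subst (q <_) e (s≤s (m≤n+m q k))) ◅ topple-bottoms k (suc q) (trans (+-suc k q) e)

  config : Config m n
  config = stage M Q

  added : Config m n
  added (inj₁ _) = 0
  added (inj₂ _) = 1

  topple-first : LegalStep m n (λ w → config w + added w) (stage 0 0)
  topple-first = inj₂ zero , ≤-reflexive (+-comm 1 M) , agrees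
    where
    agrees : ∀ w → stage 0 0 w ≡ topple m n (λ w → config w + added w) (inj₂ zero) w
    agrees (inj₁ i)       = cong suc (sym (trans (+-identityʳ _) (if-cong Q n (<⇒<ᵇ-true (toℕ<n i)))))
    agrees (inj₂ zero)    = sym (trans (cong (_∸ m) (+-comm M 1)) (n∸n≡0 m))
    agrees (inj₂ (suc j)) = sym (cong (_+ 1) (if-cong 0 m (<⇒<ᵇ-true (toℕ<n j))))

  recurrent : Recurrent m n config
  recurrent = stable , added , (inj₂ zero , s≤s z≤n) ,
              (topple-first ◅ (topple-tops M 0 (+-identityʳ M) ◅◅ topple-bottoms Q 0 (+-identityʳ Q)))
    where
    stable : Stable m n config
    stable (inj₁ i)       = subst (_< n) (sym (if-cong Q n (<⇒<ᵇ-true (toℕ<n i)))) ≤-refl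
    stable (inj₂ zero)    = ≤-refl
    stable (inj₂ (suc j)) = subst (_< m) (sym (if-cong 0 m (<⇒<ᵇ-true (toℕ<n j)))) (s≤s z≤n)

  balanced : sum (topHeights m n config) + sum (bottomHeights m n config) ≡ n * M
  balanced = begin
    sum (topHeights m n config) + sum (bottomHeights m n config)  ≡⟨ cong₂ _+_ top-sum bottom-sum ⟩
    M * Q + (M + 0)                                               ≡⟨ rearrange M Q ⟩
    n * M                                                         ∎
    where
    open ≡-Reasoning
    rearrange : ∀ M Q → M * Q + (M + 0) ≡ suc Q * M
    rearrange = solve-∀
    top-sum : sum (topHeights m n config) ≡ M * Q
    top-sum = trans (sum-allFin M (λ x → if x <ᵇ M then Q else n))
                (trans (sumUpTo-cong M (λ x x<M → if-cong Q n (<⇒<ᵇ-true x<M))) (sumUpTo-const M Q))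
    bottom-sum : sum (bottomHeights m n config) ≡ M + 0
    bottom-sum = cong (λ z → M + z) (trans (cong sum (trans (map-tabulate {n = Q} suc (λ j → config (inj₂ j)))
                                                      (tabulate-toℕ Q (λ x → if x <ᵇ Q then 0 else m))))
                               (trans (sumUpTo-cong Q (λ x x<Q → if-cong 0 m (<⇒<ᵇ-true x<Q)))
                                      (trans (sumUpTo-const Q 0) (*-zeroʳ Q))))

level-zero-recurrent : ∀ m n → 1 ≤ m → 1 ≤ n → Σ (Config m n) λ v → Recurrent m n v × (level m n v ≡ + 0)
level-zero-recurrent (suc M) (suc Q) _ _ =
  config , recurrent , Equivalence.from (level≡0⇔ (suc M) (suc Q) config) balanced
  where open LevelZero M Q

-- For recurrent u on D_{m,n}: u is minimal ⇔ f(u) is a ribbon ⇔ level(u) = 0.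
-- Levels of recurrent configurations are ≥ 0 and 0 is attained, so
-- "minimal" means "level 0", which is equivalent to "f(u) is a ribbon".
mainTheorem5 : (m n : ℕ) → 1 ≤ m → 1 ≤ n → (u : Config m n) → Recurrent m n u →
    (Minimal m n u ⇔ Ribbon m n (f m n u)) × (Ribbon m n (f m n u) ⇔ (level m n u ≡ + 0))
mainTheorem5 m n m≥1 n≥1 u rec = mk⇔ minimal⇒ribbon ribbon⇒minimal , ribbon⇔level0
  where
  ribbon⇔level0 : Ribbon m n (f m n u) ⇔ (level m n u ≡ + 0)
  ribbon⇔level0 = ribbon⇔level-zero m n m≥1 n≥1 u rec

  nonneg : ∀ v → Recurrent m n v → + 0 ℤ.≤ level m n v
  nonneg = recurrent-level-nonneg m n m≥1 n≥1

  minimal⇒ribbon : Minimal m n u → Ribbon m n (f m n u)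
  minimal⇒ribbon minimal with level-zero-recurrent m n m≥1 n≥1
  ... | v , rec-v , level-v≡0 = Equivalence.from ribbon⇔level0
        (ℤ-≤-antisym (subst (level m n u ℤ.≤_) level-v≡0 (minimal v rec-v)) (nonneg u rec))

  ribbon⇒minimal : Ribbon m n (f m n u) → Minimal m n u
  ribbon⇒minimal ribbon v rec-v =
    subst (ℤ._≤ level m n v) (sym (Equivalence.to ribbon⇔level0 ribbon)) (nonneg v rec-v)
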